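{- There are strongly connected digraphs $D$ and $H$ such that $H$ is a spanning subdigraph of $D$ and $\overrightarrow{strc}(D)>\overrightarrow{strc}(H)$.
   Context: All digraphs are finite, without loops and without multiple arcs; strongly connected means every ordered pair $(u,v)$ is joined by a directed $u$–$v$ path. A $u$–$v$ geodesic is a directed $u$–$v$ path of minimum length (number of arcs). A total-colouring colours all vertices and arcs; a directed path is total-rainbow if its arcs and internal vertices all receive pairwise distinct colours. $\overrightarrow{strc}(D)$ is the minimum number of colours in a total-colouring of $D$ such that for every ordered pair $(u,v)$ there is a total-rainbow $u$–$v$ geodesic. -}

module Defs where

open import Data.Nat using (ℕ; _≤_; _<_)
open import Data.Fin using (Fin)
open import Data.Bool using (Bool; T; false)
open import Data.List using (List; []; _∷_; _++_; map)
open import Data.List.Relation.Unary.Unique.Propositional using (Unique)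
open import Data.Product using (_×_; _,_; Σ; ∃)
open import Relation.Binary.PropositionalEquality using (_≡_)
open import Relation.Nullary using (¬_)

record Digraph (n : ℕ) : Set where
  field
    arc      : Fin n → Fin n → Bool
    loopless : ∀ v → arc v v ≡ false
open Digraph public

Arc : ∀ {n} → Digraph n → Fin n → Fin n → Set
Arc D u v = T (arc D u v)

data Walk {n : ℕ} (D : Digraph n) : Fin n → Fin n → Set where
  end  : (v : Fin n) → Walk D v v
  step : (u : Fin n) {w v : Fin n} → Arc D u w → Walk D w v → Walk D u v

module _ {n : ℕ} {D : Digraph n} where

  vertices : ∀ {u v} → Walk D u v → List (Fin n)
  vertices (end v)      = v ∷ []
  vertices (step u _ p) = u ∷ vertices p

  len : ∀ {u v} → Walk D u v → ℕ
  len (end _)      = 0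
  len (step _ _ p) = Data.Nat.suc (len p)

  initVs : ∀ {u v} → Walk D u v → List (Fin n)
  initVs (end _)      = []
  initVs (step u _ p) = u ∷ initVs p

  internal : ∀ {u v} → Walk D u v → List (Fin n)
  internal (end _)      = []
  internal (step _ _ p) = initVs p

  arcsOf : ∀ {u v} → Walk D u v → List (Fin n × Fin n)
  arcsOf (end _)             = []
  arcsOf (step u {w} _ p)    = (u , w) ∷ arcsOf p

IsPath : ∀ {n} {D : Digraph n} {u v} → Walk D u v → Set
IsPath p = Unique (vertices p)

StronglyConnected : ∀ {n} → Digraph n → Set
StronglyConnected {n} D = ∀ (u v : Fin n) → Σ (Walk D u v) IsPath

SpanningSubdigraph : ∀ {n} → Digraph n → Digraph n → Set
SpanningSubdigraph {n} H D = ∀ (u v : Fin n) → Arc H u v → Arc D u v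

IsGeodesic : ∀ {n} {D : Digraph n} {u v} → Walk D u v → Set
IsGeodesic {D = D} {u} {v} p =
  IsPath p × (∀ (q : Walk D u v) → IsPath q → len p ≤ len q)

-- A total-colouring with k colours: colours on all vertices and all arcs
-- (the value of arcCol on non-arcs is irrelevant).
record TotalColouring {n : ℕ} (D : Digraph n) (k : ℕ) : Set where
  field
    vertCol : Fin n → Fin k
    arcCol  : Fin n → Fin n → Fin k
open TotalColouring public

TotalRainbow : ∀ {n k} {D : Digraph n} → TotalColouring D k → ∀ {u v} → Walk D u v → Set
TotalRainbow c p =
  Unique (map (λ e → arcCol c (Data.Product.proj₁ e) (Data.Product.proj₂ e)) (arcsOf p)
          ++ map (vertCol c) (internal p))

IsSTRColouring : ∀ {n k} {D : Digraph n} → TotalColouring D k → Set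
IsSTRColouring {n} {D = D} c =
  ∀ (u v : Fin n) → Σ (Walk D u v) (λ p → IsGeodesic p × TotalRainbow c p)

HasSTRColouring : ∀ {n} → Digraph n → ℕ → Set
HasSTRColouring D k = Σ (TotalColouring D k) IsSTRColouring

IsStrc : ∀ {n} → Digraph n → ℕ → Set
IsStrc D k = HasSTRColouring D k × (∀ j → j < k → ¬ HasSTRColouring D j)

-- A u–v path with no shorter u–v walk and no other u–v path of its length (a
-- unique geodesic) must be total-rainbow under every strong total-rainbow
-- colouring, so arcs and internal vertices lying pairwise on common unique
-- geodesics receive pairwise distinct colours. H has seven such elements and a
-- strong total-rainbow 7-colouring in which vertex 5 shares the colour of the
-- arc 0 → 3. Adding the arc 2 → 5 makes 2 5 0 3 the unique 2–3 geodesic, which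
-- separates these two and yields eight such elements in D. The upper bounds are
-- certified by enumerating walks of increasing length until a total-rainbow path
-- with no shorter walk appears.

module Submission where

open import Defs
open import Agda.Builtin.FromNat using (Number; fromNat)
open import Data.Bool using (Bool; not; _∧_)
open import Data.Bool.Properties using (T-irrelevant)
open import Data.Unit using (tt)
open import Data.Fin using (Fin) renaming (_≟_ to _≟ᶠ_)
import Data.Fin.Literals
import Data.Nat.Literals
open import Data.Fin.Properties using (injective⇒≤) renaming (all? to allFin?)
open import Data.List using (List; []; _∷_; _++_; map; concatMap; upTo; allFin)
open import Data.List.Membership.Propositional using (_∈_)
open import Data.List.Membership.Propositional.Properties using (∈-map⁺; ∈-concatMap⁺; ∈-allFin; ∈-upTo⁺)
import Data.List.Membership.DecPropositional
open import Data.List.Properties using (∷-injectiveˡ; ∷-injectiveʳ; map-++; map-∘) renaming (≡-dec to List-≡-dec)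
open import Data.List.Relation.Unary.All as All using (All; []; _∷_; all?)
open import Data.List.Relation.Unary.All.Properties using (map⁻)
open import Data.List.Relation.Unary.Any as Any using (Any; here; there; any?; satisfied)
open import Data.List.Relation.Unary.AllPairs using (_∷_)
open import Data.List.Relation.Unary.Unique.Propositional using (Unique)
open import Data.List.Relation.Unary.Unique.DecPropositional using (unique?)
open import Data.Nat using (ℕ; zero; suc; _<_; _≤_)
open import Data.Nat.Properties using (≤-antisym; ≮⇒≥; <⇒≱; ≤-refl)
open import Data.Product using (Σ; ∃₂; _×_; _,_; proj₁; proj₂)
open import Data.Product.Properties using () renaming (≡-dec to ×-≡-dec)
open import Data.Sum using (_⊎_; inj₁; inj₂)
open import Data.Sum.Properties using () renaming (≡-dec to ⊎-≡-dec)
open import Data.Vec using (Vec; []; _∷_; lookup)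
open import Function using (case_of_)
open import Relation.Binary.Definitions using (DecidableEquality)
open import Relation.Binary.PropositionalEquality using (_≡_; _≢_; refl; sym; cong; cong₂; subst; module ≡-Reasoning)
open import Relation.Nullary using (¬?; Dec; yes; no; does; contradiction; map′)
open import Relation.Nullary.Decidable using (from-yes; dec-true; T?; _×-dec_; _→-dec_)

Element : ℕ → Set
Element n = (Fin n × Fin n) ⊎ Fin n

pattern arcᵉ u v = inj₁ (u , v)
pattern vertexᵉ v = inj₂ v

Unique-map⇒injectiveOn : ∀ {A B : Set} {f : A → B} {xs : List A} → Unique (map f xs) →
                         ∀ {x y} → x ∈ xs → y ∈ xs → f x ≡ f y → x ≡ y
Unique-map⇒injectiveOn (_ ∷ _) (here refl) (here refl) _ = refl
Unique-map⇒injectiveOn (fx∉ ∷ _) (here refl) (there y∈) fx≡fy =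
  contradiction fx≡fy (All.lookup (map⁻ fx∉) y∈)
Unique-map⇒injectiveOn (fy∉ ∷ _) (there x∈) (here refl) fx≡fy =
  contradiction (sym fx≡fy) (All.lookup (map⁻ fy∉) x∈)
Unique-map⇒injectiveOn (_ ∷ unique) (there x∈) (there y∈) = Unique-map⇒injectiveOn unique x∈ y∈

fromArcs : ∀ {n} → List (Fin n × Fin n) → Digraph n
fromArcs {n} arcs = record
  { arc      = λ u v → not (does (u ≟ᶠ v)) ∧ listed u v
  ; loopless = λ v → cong (λ b → not b ∧ listed v v) (dec-true (v ≟ᶠ v) refl)
  }
  where
  open Data.List.Membership.DecPropositional (×-≡-dec _≟ᶠ_ _≟ᶠ_) using (_∈?_)
  listed : Fin n → Fin n → Bool
  listed u v = does ((u , v) ∈? arcs)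

module _ {n : ℕ} {D : Digraph n} where

  vertices-determine-walk : ∀ {u u′ v} (p : Walk D u v) (q : Walk D u′ v) →
                            vertices p ≡ vertices q → Σ (u ≡ u′) λ { refl → p ≡ q }
  vertices-determine-walk (end _) (end _) refl = refl , refl
  vertices-determine-walk (end _) (step _ _ (end _)) ()
  vertices-determine-walk (end _) (step _ _ (step _ _ _)) ()
  vertices-determine-walk (step _ _ (end _)) (end _) ()
  vertices-determine-walk (step _ _ (step _ _ _)) (end _) ()
  vertices-determine-walk (step u a p) (step _ b q) eq
    with refl ← ∷-injectiveˡ eq
    with refl , refl ← vertices-determine-walk p q (∷-injectiveʳ eq)
    = refl , cong (λ a → step u a p) (T-irrelevant a b)

  vertices-injective : ∀ {u v} {p q : Walk D u v} → vertices p ≡ vertices q → p ≡ q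
  vertices-injective {p = p} {q} eq with refl , p≡q ← vertices-determine-walk p q eq = p≡q

  _≟ʷ_ : ∀ {u v} → DecidableEquality (Walk D u v)
  p ≟ʷ q = map′ vertices-injective (cong vertices) (List-≡-dec _≟ᶠ_ (vertices p) (vertices q))

  mutual
    walksOfLength : ℕ → (u v : Fin n) → List (Walk D u v)
    walksOfLength zero u v with u ≟ᶠ v
    ... | yes refl = end u ∷ []
    ... | no _     = []
    walksOfLength (suc m) u v = concatMap (λ w → walksVia m w (T? (arc D u w))) (allFin n)

    walksVia : ∀ {u v} → ℕ → (w : Fin n) → Dec (Arc D u w) → List (Walk D u v)
    walksVia {v = v} m w (yes a) = map (step _ a) (walksOfLength m w v)
    walksVia m w (no _) = []

  ∈-walksOfLength : ∀ {u v} (p : Walk D u v) → p ∈ walksOfLength (len p) u v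
  ∈-walksOfLength (end v) with v ≟ᶠ v
  ... | yes refl = here refl
  ... | no v≢v   = contradiction refl v≢v
  ∈-walksOfLength (step u {w} a p) =
    ∈-concatMap⁺ _ (Any.map (λ { refl → ∈-walksVia (T? (arc D u w)) }) (∈-allFin w))
    where
    ∈-walksVia : (a? : Dec (Arc D u w)) → step u a p ∈ walksVia (len p) w a?
    ∈-walksVia (yes b) with refl ← T-irrelevant a b = ∈-map⁺ (step u a) (∈-walksOfLength p)
    ∈-walksVia (no ¬a) = contradiction a ¬a

  NoShorterWalk : ∀ {u v} → Walk D u v → Set
  NoShorterWalk {u} {v} p = All (λ m → walksOfLength m u v ≡ []) (upTo (len p))

  shortest-path⇒geodesic : ∀ {u v} {p : Walk D u v} → IsPath p → NoShorterWalk p → IsGeodesic p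
  shortest-path⇒geodesic {p = p} path none = path , λ q _ → ≮⇒≥ λ q<p →
    case subst (q ∈_) (All.lookup none (∈-upTo⁺ q<p)) (∈-walksOfLength q) of λ ()

  isPath? : ∀ {u v} (p : Walk D u v) → Dec (IsPath p)
  isPath? p = unique? _≟ᶠ_ (vertices p)

  noShorterWalk? : ∀ {u v} (p : Walk D u v) → Dec (NoShorterWalk p)
  noShorterWalk? p = all? (λ m → List-≡-dec _≟ʷ_ (walksOfLength m _ _) []) (upTo (len p))

  IsUniqueGeodesic : ∀ {u v} → Walk D u v → Set
  IsUniqueGeodesic {u} {v} p =
    IsPath p × NoShorterWalk p × All (λ q → IsPath q → q ≡ p) (walksOfLength (len p) u v)

  unique-geodesic-rainbow : ∀ {k} {c : TotalColouring D k} → IsSTRColouring c →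
                            ∀ {u v} {p : Walk D u v} → IsUniqueGeodesic p → TotalRainbow c p
  unique-geodesic-rainbow str {u} {v} {p} (p-path , p-shortest , p-only)
    with q , (q-path , q-minimal) , q-rainbow ← str u v = subst (TotalRainbow _) (q≡p) q-rainbow
    where
    same-length : len q ≡ len p
    same-length = ≤-antisym (q-minimal p p-path)
                            (proj₂ (shortest-path⇒geodesic p-path p-shortest) q q-path)
    q≡p : q ≡ p
    q≡p = All.lookup p-only (subst (λ m → q ∈ walksOfLength m u v) same-length (∈-walksOfLength q))
                     q-path

  isUniqueGeodesic? : ∀ {u v} (p : Walk D u v) → Dec (IsUniqueGeodesic p)
  isUniqueGeodesic? p =
    isPath? p ×-dec noShorterWalk? p ×-dec
    all? (λ q → isPath? q →-dec q ≟ʷ p) (walksOfLength (len p) _ _)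

  elements : ∀ {u v} → Walk D u v → List (Element n)
  elements p = map inj₁ (arcsOf p) ++ map inj₂ (internal p)

  colourOf : ∀ {k} → TotalColouring D k → Element n → Fin k
  colourOf c (arcᵉ u v) = arcCol c u v
  colourOf c (vertexᵉ v) = vertCol c v

  totalRainbow⇒unique-colours : ∀ {k} {c : TotalColouring D k} {u v} {p : Walk D u v} →
                                TotalRainbow c p → Unique (map (colourOf c) (elements p))
  totalRainbow⇒unique-colours {c = c} {p = p} = subst Unique (sym colours-of-elements)
    where
    open ≡-Reasoning
    colours-of-elements : map (colourOf c) (elements p) ≡
                          map (λ e → arcCol c (proj₁ e) (proj₂ e)) (arcsOf p) ++ map (vertCol c) (internal p)
    colours-of-elements = begin
      map (colourOf c) (map inj₁ (arcsOf p) ++ map inj₂ (internal p))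
        ≡⟨ map-++ (colourOf c) (map inj₁ (arcsOf p)) _ ⟩
      map (colourOf c) (map inj₁ (arcsOf p)) ++ map (colourOf c) (map inj₂ (internal p))
        ≡⟨ cong₂ _++_ (sym (map-∘ (arcsOf p))) (sym (map-∘ (internal p))) ⟩
      map (λ e → arcCol c (proj₁ e) (proj₂ e)) (arcsOf p) ++ map (vertCol c) (internal p) ∎

  unique-geodesic-colours-injective : ∀ {k} {c : TotalColouring D k} → IsSTRColouring c →
                                      ∀ {u v} {p : Walk D u v} → IsUniqueGeodesic p →
                                      ∀ {x y} → x ∈ elements p → y ∈ elements p →
                                      colourOf c x ≡ colourOf c y → x ≡ y
  unique-geodesic-colours-injective str {p = p} geodesic =
    Unique-map⇒injectiveOn (totalRainbow⇒unique-colours {p = p} (unique-geodesic-rainbow str geodesic))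

  PairwiseCovered : ∀ {m} → List (∃₂ (Walk D)) → (Fin m → Element n) → Set
  PairwiseCovered ps S =
    ∀ i j → i ≢ j → S i ≢ S j × Any (λ (_ , _ , p) → S i ∈ elements p × S j ∈ elements p) ps

  strc-lower-bound : ∀ {m k} (ps : List (∃₂ (Walk D))) (S : Fin m → Element n) →
                     All (λ (_ , _ , p) → IsUniqueGeodesic p) ps → PairwiseCovered ps S →
                     HasSTRColouring D k → m ≤ k
  strc-lower-bound ps S geodesics covered (c , str) = injective⇒≤ colour∘S-injective
    where
    colour∘S-injective : ∀ {i j} → colourOf c (S i) ≡ colourOf c (S j) → i ≡ j
    colour∘S-injective {i} {j} same with i ≟ᶠ j
    ... | yes i≡j = i≡j
    ... | no i≢j with Si≢Sj , common ← covered i j i≢j =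
      contradiction (All.lookupWith {R = λ _ → S i ≡ S j}
                       (λ geodesic (Si∈ , Sj∈) → unique-geodesic-colours-injective str geodesic Si∈ Sj∈ same)
                       geodesics common)
                    Si≢Sj

  pairwiseCovered? : ∀ {m} (ps : List (∃₂ (Walk D))) (S : Fin m → Element n) → Dec (PairwiseCovered ps S)
  pairwiseCovered? ps S = allFin? λ i → allFin? λ j →
    ¬? (i ≟ᶠ j) →-dec ¬? (element-≟ (S i) (S j)) ×-dec
                      any? (λ (_ , _ , p) → (S i ∈? elements p) ×-dec (S j ∈? elements p)) ps
    where
    element-≟ : DecidableEquality (Element n)
    element-≟ = ⊎-≡-dec (×-≡-dec _≟ᶠ_ _≟ᶠ_) _≟ᶠ_
    open Data.List.Membership.DecPropositional element-≟ using (_∈?_)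

  totalRainbow? : ∀ {k} (c : TotalColouring D k) {u v} (p : Walk D u v) → Dec (TotalRainbow c p)
  totalRainbow? c p = unique? _≟ᶠ_ _

  walksShorterThan : ℕ → (u v : Fin n) → List (Walk D u v)
  walksShorterThan m u v = concatMap (λ l → walksOfLength l u v) (upTo m)

  RainbowShortestPath : ∀ {k} → TotalColouring D k → ∀ {u v} → Walk D u v → Set
  RainbowShortestPath c p = IsPath p × NoShorterWalk p × TotalRainbow c p

  -- Every path has fewer than n arcs, so this search misses no geodesic.
  FoundRainbowShortestPaths : ∀ {k} → TotalColouring D k → Set
  FoundRainbowShortestPaths c = ∀ u v → Any (RainbowShortestPath c) (walksShorterThan n u v)

  foundRainbowShortestPaths? : ∀ {k} (c : TotalColouring D k) → Dec (FoundRainbowShortestPaths c)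
  foundRainbowShortestPaths? c = allFin? λ u → allFin? λ v →
    any? (λ p → isPath? p ×-dec noShorterWalk? p ×-dec totalRainbow? c p) (walksShorterThan n u v)

  found⇒isSTRColouring : ∀ {k} {c : TotalColouring D k} → FoundRainbowShortestPaths c → IsSTRColouring c
  found⇒isSTRColouring found u v with p , path , shortest , rainbow ← satisfied (found u v) =
    p , shortest-path⇒geodesic path shortest , rainbow

  isSTRColouring⇒stronglyConnected : ∀ {k} {c : TotalColouring D k} → IsSTRColouring c → StronglyConnected D
  isSTRColouring⇒stronglyConnected str u v with p , (path , _) , _ ← str u v = p , path

  isStrc : ∀ {m} (c : TotalColouring D m) → IsSTRColouring c →
           (∀ {k} → HasSTRColouring D k → m ≤ k) → IsStrc D m
  isStrc c str lower = (c , str) , λ j j<m has → <⇒≱ j<m (lower has)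

instance
  ℕ-literals : Number ℕ
  ℕ-literals = Data.Nat.Literals.number
  Fin-literals : ∀ {n} → Number (Fin n)
  Fin-literals {n} = Data.Fin.Literals.number n

arcsH : List (Fin 7 × Fin 7)
arcsH = (0 , 3) ∷ (1 , 2) ∷ (1 , 3) ∷ (1 , 4) ∷ (2 , 4) ∷ (3 , 4) ∷ (4 , 6)
      ∷ (5 , 0) ∷ (5 , 4) ∷ (6 , 1) ∷ (6 , 2) ∷ (6 , 4) ∷ (6 , 5) ∷ []

H D : Digraph 7
H = fromArcs arcsH
D = fromArcs ((2 , 5) ∷ arcsH)

-- Entries of arcColours at non-arcs are irrelevant.
colouringH : TotalColouring H 7
colouringH = record
  { vertCol = lookup (1 ∷ 4 ∷ 0 ∷ 4 ∷ 5 ∷ 0 ∷ 6 ∷ [])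
  ; arcCol  = λ u v → lookup (lookup arcColours u) v
  }
  where
  arcColours : Vec (Vec (Fin 7) 7) 7
  arcColours = (0 ∷ 0 ∷ 0 ∷ 0 ∷ 0 ∷ 0 ∷ 0 ∷ [])
             ∷ (0 ∷ 0 ∷ 0 ∷ 0 ∷ 1 ∷ 0 ∷ 0 ∷ [])
             ∷ (0 ∷ 0 ∷ 0 ∷ 0 ∷ 1 ∷ 0 ∷ 0 ∷ [])
             ∷ (0 ∷ 0 ∷ 0 ∷ 0 ∷ 1 ∷ 0 ∷ 0 ∷ [])
             ∷ (0 ∷ 0 ∷ 0 ∷ 0 ∷ 0 ∷ 0 ∷ 2 ∷ [])
             ∷ (4 ∷ 0 ∷ 0 ∷ 0 ∷ 0 ∷ 0 ∷ 0 ∷ [])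
             ∷ (0 ∷ 3 ∷ 3 ∷ 0 ∷ 0 ∷ 3 ∷ 0 ∷ [])
             ∷ []

colouringH-isSTR : IsSTRColouring colouringH
colouringH-isSTR = found⇒isSTRColouring (from-yes (foundRainbowShortestPaths? colouringH))

colouringD : TotalColouring D 8
colouringD = record
  { vertCol = lookup (2 ∷ 1 ∷ 2 ∷ 4 ∷ 5 ∷ 7 ∷ 6 ∷ [])
  ; arcCol  = λ u v → lookup (lookup arcColours u) v
  }
  where
  arcColours : Vec (Vec (Fin 8) 7) 7
  arcColours = (0 ∷ 0 ∷ 0 ∷ 0 ∷ 0 ∷ 0 ∷ 0 ∷ [])
             ∷ (0 ∷ 0 ∷ 0 ∷ 0 ∷ 0 ∷ 0 ∷ 0 ∷ [])
             ∷ (0 ∷ 0 ∷ 0 ∷ 0 ∷ 0 ∷ 1 ∷ 0 ∷ [])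
             ∷ (0 ∷ 0 ∷ 0 ∷ 0 ∷ 1 ∷ 0 ∷ 0 ∷ [])
             ∷ (0 ∷ 0 ∷ 0 ∷ 0 ∷ 0 ∷ 0 ∷ 2 ∷ [])
             ∷ (4 ∷ 0 ∷ 0 ∷ 0 ∷ 0 ∷ 0 ∷ 0 ∷ [])
             ∷ (0 ∷ 3 ∷ 3 ∷ 0 ∷ 0 ∷ 3 ∷ 0 ∷ [])
             ∷ []

colouringD-isSTR : IsSTRColouring colouringD
colouringD-isSTR = found⇒isSTRColouring (from-yes (foundRainbowShortestPaths? colouringD))

forcedH : List (∃₂ (Walk H))
forcedH = (_ , _ , step 0 tt (step 3 tt (step 4 tt (step 6 tt (end 1)))))
        ∷ (_ , _ , step 0 tt (step 3 tt (step 4 tt (step 6 tt (end 5)))))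
        ∷ (_ , _ , step 5 tt (step 0 tt (end 3)))
        ∷ (_ , _ , step 3 tt (step 4 tt (step 6 tt (step 5 tt (end 0)))))
        ∷ (_ , _ , step 1 tt (step 4 tt (step 6 tt (step 5 tt (end 0)))))
        ∷ []

forcedD : List (∃₂ (Walk D))
forcedD = (_ , _ , step 0 tt (step 3 tt (step 4 tt (step 6 tt (end 1)))))
        ∷ (_ , _ , step 0 tt (step 3 tt (step 4 tt (step 6 tt (end 5)))))
        ∷ (_ , _ , step 2 tt (step 5 tt (step 0 tt (end 3))))
        ∷ (_ , _ , step 3 tt (step 4 tt (step 6 tt (step 5 tt (end 0)))))
        ∷ (_ , _ , step 1 tt (step 2 tt (step 5 tt (end 0))))
        ∷ []

separatedH : Fin 7 → Element 7
separatedH = lookup (arcᵉ 0 3 ∷ arcᵉ 3 4 ∷ arcᵉ 4 6 ∷ arcᵉ 5 0 ∷ arcᵉ 6 5 ∷ vertexᵉ 4 ∷ vertexᵉ 6 ∷ [])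

separatedD : Fin 8 → Element 7
separatedD = lookup (arcᵉ 0 3 ∷ arcᵉ 3 4 ∷ arcᵉ 4 6 ∷ arcᵉ 5 0 ∷ arcᵉ 6 5 ∷ vertexᵉ 4 ∷ vertexᵉ 5 ∷ vertexᵉ 6 ∷ [])

strc-H : IsStrc H 7
strc-H = isStrc colouringH colouringH-isSTR
  (strc-lower-bound forcedH separatedH
    (from-yes (all? (λ (_ , _ , p) → isUniqueGeodesic? p) forcedH))
    (from-yes (pairwiseCovered? forcedH separatedH)))

strc-D : IsStrc D 8
strc-D = isStrc colouringD colouringD-isSTR
  (strc-lower-bound forcedD separatedD
    (from-yes (all? (λ (_ , _ , p) → isUniqueGeodesic? p) forcedD))
    (from-yes (pairwiseCovered? forcedD separatedD)))

H-spanning-D : SpanningSubdigraph H D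
H-spanning-D = from-yes (allFin? λ u → allFin? λ v → T? (arc H u v) →-dec T? (arc D u v))

lemma6 : Σ ℕ (λ n → Σ (Digraph n) (λ D → Σ (Digraph n) (λ H →
           StronglyConnected D × StronglyConnected H × SpanningSubdigraph H D ×
           Σ ℕ (λ kD → Σ ℕ (λ kH → IsStrc D kD × IsStrc H kH × kH < kD)))))
lemma6 = 7 , D , H
       , isSTRColouring⇒stronglyConnected colouringD-isSTR
       , isSTRColouring⇒stronglyConnected colouringH-isSTR
       , H-spanning-D
       , 8 , 7 , strc-D , strc-H , ≤-refl
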